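{- For any set $X$, the quotient map $\pi:\mathrm{Path}(X)\to\mathrm{Path}_\sim(X)$, $p\mapsto[p]_\sim$, is order preserving. Consequently $\pi$ is Borel measurable, where $\mathrm{Path}(X)$ and $\mathrm{Path}_\sim(X)$ carry the Borel $\sigma$-algebras of their Alexandroff topologies.
   Context: Fix a set $A$, $\tau\notin A$, $A_\tau=A\cup\{\tau\}$, $A_\tau^*$ the finite words, $\epsilon$ the empty word, ${\downarrow}\sigma$ the set of prefixes of $\sigma$. A path on $X$ is a function $p$ into $X$ with domain ${\downarrow}\sigma$ for some $\sigma\in A_\tau^*$; $\mathrm{Path}(X)$ is the set of paths, ordered by $p\preceq q$ iff $\mathrm{dom}\,p\subseteq\mathrm{dom}\,q$ and $q$ agrees with $p$ on $\mathrm{dom}\,p$. The stutter basis of $p$ is the unique $\phi:\mathrm{dom}\,p\to A_\tau^*$ with $\phi(\epsilon)=\epsilon$; $\phi(\sigma'\tau)=\phi(\sigma')$ if $p(\sigma'\tau)=p(\sigma')$; $\phi(\sigma'\tau)=\phi(\sigma')\tau$ if $p(\sigma'\tau)\ne p(\sigma')$; $\phi(\sigma'a)=\phi(\sigma')a$ for $a\in A$. $\mathrm{st}(p)$ is the path with domain $\phi(\mathrm{dom}\,p)$ with $\mathrm{st}(p)\circ\phi=p$; $p\sim q$ iff $\mathrm{st}(p)=\mathrm{st}(q)$; $\mathrm{Path}_\sim(X)=\mathrm{Path}(X)/{\sim}$, ordered by $[p]\preceq[q]$ iff $\mathrm{st}(p)\preceq\mathrm{st}(q)$. The Alexandroff topology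 of a poset has as open sets exactly the upward closed subsets. -}

module Defs where

open import Level using (Level; _⊔_) renaming (suc to lsuc; zero to lzero)
open import Data.Nat using (ℕ)
open import Data.List using (List; []; _∷_; _++_)
open import Data.Product using (Σ; _×_; _,_; ∃)
open import Relation.Binary.PropositionalEquality using (_≡_; _≢_)
open import Relation.Nullary using (¬_)

data Letter (A : Set) : Set where
  τ   : Letter A
  act : A → Letter A

-- A path p : ↓σ → X with σ = l₁ l₂ … lₙ is encoded by
--   start = p(ε),  steps = (l₁ , p(l₁)) ∷ (l₂ , p(l₁l₂)) ∷ … ∷ (lₙ , p(σ)).
-- This is a bijective encoding of Path(X).
record Path (A X : Set) : Set where
  constructor path
  field
    start : X
    steps : List (Letter A × X)
open Path public

module _ {A X : Set} where

  -- p ≼ q : dom p ⊆ dom q and q agrees with p on dom p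
  _≼_ : Path A X → Path A X → Set
  p ≼ q = start p ≡ start q × ∃ λ ys → steps q ≡ steps p ++ ys

  -- StGo x r r' : r' is the stutter-reduced version of the step list r,
  -- where x is the value at the current (previous) position.
  -- This is the graph of the stutter basis construction φ.
  data StGo : X → List (Letter A × X) → List (Letter A × X) → Set where
    nil   : ∀ {x} → StGo x [] []
    stut  : ∀ {x r r'} → StGo x r r' → StGo x ((τ , x) ∷ r) r'
    τmove : ∀ {x y r r'} → y ≢ x → StGo y r r' → StGo x ((τ , y) ∷ r) ((τ , y) ∷ r')
    amove : ∀ {x y a r r'} → StGo y r r' → StGo x ((act a , y) ∷ r) ((act a , y) ∷ r')

  IsSt : Path A X → Path A X → Set
  IsSt p r = start r ≡ start p × StGo (start p) (steps p) (steps r)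

  _∼_ : Path A X → Path A X → Set
  p ∼ q = ∀ r s → IsSt p r → IsSt q s → r ≡ s

  -- [p] ≼ [q] iff st(p) ≼ st(q)
  _≼∼_ : Path A X → Path A X → Set
  p ≼∼ q = ∀ r s → IsSt p r → IsSt q s → r ≼ s

  -- Path_∼(X) is represented by representatives in Path(X) (setoid style);
  -- the quotient map π is the identity on representatives.
  π : Path A X → Path A X
  π p = p

  PredP : Set₁
  PredP = Path A X → Set

  -- Alexandroff-open subsets of Path(X): upward closed sets
  OpenP : PredP → Set
  OpenP U = ∀ p q → p ≼ q → U p → U q

  -- subsets of Path_∼(X) = ∼-saturated predicates on representatives;
  -- Alexandroff-open ones: saturated and upward closed for ≼∼
  OpenQ : PredP → Set
  OpenQ U = (∀ p q → p ∼ q → U p → U q) × (∀ p q → p ≼∼ q → U p → U q)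

data σGen {T : Set} (G : (T → Set) → Set) : (T → Set) → Set₁ where
  gen   : ∀ {U} → G U → σGen G U
  compl : ∀ {U} → σGen G U → σGen G (λ t → ¬ U t)
  union : ∀ {U : ℕ → T → Set} → (∀ n → σGen G (U n)) → σGen G (λ t → Σ ℕ λ n → U n t)

module _ {A X : Set} where
  BorelP : (Path A X → Set) → Set₁
  BorelP = σGen (OpenP {A} {X})

  BorelQ : (Path A X → Set) → Set₁
  BorelQ = σGen (OpenQ {A} {X})

  Measurableπ : Set₁
  Measurableπ = ∀ V → BorelQ V → BorelP (λ p → V (π {A} {X} p))

  OrderPreservingπ : Set
  OrderPreservingπ = ∀ (p q : Path A X) → p ≼ q → π p ≼∼ π q

module Submission where

-- Order preservation reduces to a fact about the stutter reduction of step
-- lists: the reduction is computed letter by letter, so if r' reduces a step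
-- list l, then every reduction of an extension l ++ ys extends r'.  Given
-- p ≼ q, the step list of q extends that of p and both reductions start from
-- the same value, so st(p) ≼ st(q).
--
-- Measurability is then the usual two-step argument: a monotone map between
-- preorders pulls Alexandroff-open (upward closed) sets back to open sets,
-- and any map pulling generators of one σ-algebra back into generators of
-- another pulls the whole generated σ-algebra back (induction on σGen).

open import Defs
open import Data.Product using (_×_; _,_; ∃)
open import Data.List using (_∷_; _++_)
open import Relation.Binary.PropositionalEquality using (_≡_; refl; trans; sym; cong; subst)
open import Data.Empty using (⊥-elim)

σGen-preimage : {S T : Set} {G : (S → Set) → Set} {H : (T → Set) → Set}
  (f : S → T) → (∀ U → H U → G (λ s → U (f s))) →
  ∀ V → σGen H V → σGen G (λ s → V (f s))
σGen-preimage f gens V (gen hV)   = gen (gens V hV)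
σGen-preimage f gens _ (compl b)  = compl (σGen-preimage f gens _ b)
σGen-preimage f gens _ (union bs)   = union (λ n → σGen-preimage f gens _ (bs n))

module _ {A X : Set} where

  stutter-prefix : ∀ {x l r' ys s'} → StGo {A} {X} x l r' → StGo x (l ++ ys) s' →
    ∃ λ zs → s' ≡ r' ++ zs
  stutter-prefix {s' = s'} nil d'               = s' , refl
  stutter-prefix (stut d)      (stut d')       = stutter-prefix d d'
  stutter-prefix (stut d)      (τmove y≢x d')  = ⊥-elim (y≢x refl)
  stutter-prefix (τmove y≢x d) (stut d')       = ⊥-elim (y≢x refl)
  stutter-prefix (τmove _ d)   (τmove _ d')    with stutter-prefix d d'
  ... | zs , e = zs , cong (_ ∷_) e
  stutter-prefix (amove d)     (amove d')      with stutter-prefix d d'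
  ... | zs , e = zs , cong (_ ∷_) e

  π-order-preserving : OrderPreservingπ {A} {X}
  π-order-preserving p q (same-start , ys , refl) r s (r-start , dr) (s-start , ds) =
    trans r-start (trans same-start (sym s-start)) ,
    stutter-prefix dr (subst (λ x → StGo x _ _) (sym same-start) ds)

  π-continuous : ∀ U → OpenQ U → OpenP {A} {X} (λ p → U (π p))
  π-continuous U (_ , upward) p q p≼q = upward p q (π-order-preserving p q p≼q)

theorem27 : (A X : Set) → OrderPreservingπ {A} {X} × Measurableπ {A} {X}
theorem27 A X = π-order-preserving , σGen-preimage π π-continuous
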